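{- Let $x$ be any feasible solution of the linear program $\mathrm{LP}$ defined in the context. Then there exist nonnegative weights $\lambda_{I,j}$, indexed by pairs $(I,j)$ such that $M_{I,j}$ is a monochromatic sequence matching, satisfying all of the following: (a) for each item $i$, $\sum_{(I,j):\, i\in I}\lambda_{I,j}=1$; (b) for each time slot $t\in\{k+1,\dots,k+n\}$, $\sum_{(I,j):\, t\in[j+1,\,j+|I|]}\lambda_{I,j}=1$; (c) $z(x)=\sum_{(I,j)}\lambda_{I,j}$.
   Context: Setting: there is a buffer capacity $k\in\mathbb{N}$ and $n$ items $1,\dots,n$ with colors $c(1),\dots,c(n)$. Notation: for an item $i$, ${\rm last}(i)$ is the last item of color $c(i)$. For $i\ne{\rm last}(i)$, $n(i)$ is the next item after $i$ of color $c(i)$; for $i={\rm last}(i)$ set $n(i)=k+n+2$. The linear program $\mathrm{LP}$ has variables $x_{i,j}$ for $i=1,\dots,n$ and $j=\max\{k+1,i\},\dots,k+n$. Any $x_{i,j}$ with indices outside this range is treated as $0$. Its objective is $z(x)=\sum_{i=1}^n\sum_{j=\max\{i,k+1\}}^{n(i)-2}x_{i,j}$. Its constraints are: - $\sum_{j=\max\{i,k+1\}}^{k+n}x_{i,j}=1$ for all $i$; - $\sum_{i\le\min\{j,n\}}x_{i,j}=1$ for all $j\in\{k+1,\dots,k+n\}$; - $x_{n(i),j}-x_{i,j-1}\ge0$ for all $i\ne{\rm last}(i)$ and all $j\ge n(i)$; - $x_{i,j}\ge0$. Monochromatic sequence matching: let $I=(i_1,\dots,i_m)$ be a sequence of items and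 $j$ an integer. The matching $M_{I,j}$ sends $i_s\mapsto j+s$ for $s=1,\dots,m$. It is called a monochromatic sequence matching (MSM) if: (i) $c(i_s)=c(i_{s+1})$ and $n(i_s)=i_{s+1}$ for all $s=1,\dots,m-1$; (ii) $j+s\ge i_s$ for all $s=1,\dots,m$; (iii) $j+m<n(i_m)-1$. Here $|I|=m$.
   Formalization: The feasible solution x of LP takes only rational values, and the weights $\lambda_{I,j}$ are taken in the rationals. -}

module Defs where

open import Data.Nat using (ℕ; zero; suc; _+_; _∸_; _≤_; _<_; _≡ᵇ_; _≤ᵇ_; _⊔_; _⊓_)
open import Data.Bool using (Bool; true; false; if_then_else_; _∧_)
open import Data.List using (List; []; _∷_; map; upTo; sum; foldr; length; last)
open import Data.Bool.ListAction using (any)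
open import Data.List.Relation.Unary.All using (All)
open import Data.List.Relation.Unary.Unique.Propositional using (Unique)
open import Data.Maybe using (Maybe; just; nothing)
open import Data.Product using (_×_; _,_; Σ; proj₁; proj₂)
open import Data.Unit using (⊤)
open import Data.Empty using (⊥)
open import Relation.Binary.PropositionalEquality using (_≡_; _≢_)
open import Data.Rational using (ℚ; 0ℚ; 1ℚ) renaming (_+_ to _+ℚ_; _≤_ to _≤ℚ_)

-- The integer interval [a, b] = a, a+1, ..., b (empty if b < a).
interval : ℕ → ℕ → List ℕ
interval a b = map (a +_) (upTo (suc b ∸ a))

sumℚ : {A : Set} → (A → ℚ) → List A → ℚ
sumℚ f = foldr (λ a acc → f a +ℚ acc) 0ℚ

Σ[_,_] : ℕ → ℕ → (ℕ → ℚ) → ℚ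
Σ[ a , b ] f = sumℚ f (interval a b)

-- An instance: buffer capacity k, number of items n, colouring c.
-- Items are 1,...,n; only the values c 1, ..., c n matter.

module Instance (k n : ℕ) (c : ℕ → ℕ) where

  search : ℕ → ℕ → ℕ → Maybe ℕ
  search col s zero = nothing
  search col s (suc f) = if c s ≡ᵇ col then just s else search col (suc s) f

  nextM : ℕ → Maybe ℕ
  nextM i = search (c i) (suc i) (n ∸ i)

  nxt : ℕ → ℕ
  nxt i with nextM i
  ... | just i' = i'
  ... | nothing = k + n + 2

  NotLast : ℕ → Set
  NotLast i = Σ ℕ (λ i' → nextM i ≡ just i')

  IsItem : ℕ → Set
  IsItem i = (1 ≤ i) × (i ≤ n)

  -- (i, j) indexes an LP variable: 1 ≤ i ≤ n, max(k+1,i) ≤ j ≤ k+n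
  inRange : ℕ → ℕ → Bool
  inRange i j = (1 ≤ᵇ i) ∧ (i ≤ᵇ n) ∧ ((suc k ⊔ i) ≤ᵇ j) ∧ (j ≤ᵇ k + n)

  xv : (ℕ → ℕ → ℚ) → ℕ → ℕ → ℚ
  xv X i j = if inRange i j then X i j else 0ℚ

  Feasible : (ℕ → ℕ → ℚ) → Set
  Feasible X =
      (∀ i → IsItem i → Σ[ suc k ⊔ i , k + n ] (λ j → xv X i j) ≡ 1ℚ)
    × (∀ j → suc k ≤ j → j ≤ k + n → Σ[ 1 , j ⊓ n ] (λ i → xv X i j) ≡ 1ℚ)
    × (∀ i → IsItem i → NotLast i → ∀ j → nxt i ≤ j →
         xv X i (j ∸ 1) ≤ℚ xv X (nxt i) j)
    × (∀ i j → 0ℚ ≤ℚ xv X i j)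

  z : (ℕ → ℕ → ℚ) → ℚ
  z X = Σ[ 1 , n ] (λ i → Σ[ suc k ⊔ i , nxt i ∸ 2 ] (λ j → xv X i j))

  Chain : List ℕ → Set
  Chain [] = ⊤
  Chain (_ ∷ []) = ⊤
  Chain (a ∷ b ∷ r) = (c a ≡ c b) × (nxt a ≡ b) × Chain (b ∷ r)

  -- (ii) j + s ≥ i_s for s = 1..m
  Fits : ℕ → List ℕ → Set
  Fits j [] = ⊤
  Fits j (i ∷ r) = (i ≤ suc j) × Fits (suc j) r

  EndOK : ℕ → List ℕ → Set
  EndOK j I = ∀ im → last I ≡ just im → j + length I < nxt im ∸ 1

  IsMSM : List ℕ → ℕ → Set
  IsMSM I j = (I ≢ []) × All IsItem I × Chain I × Fits j I × EndOK j I

  -- weighted MSMs: entries (I , j , λ_{I,j})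
  Entry : Set
  Entry = List ℕ × ℕ × ℚ

  seqOf : Entry → List ℕ
  seqOf (I , _ , _) = I

  startOf : Entry → ℕ
  startOf (_ , j , _) = j

  weight : Entry → ℚ
  weight (_ , _ , w) = w

  key : Entry → List ℕ × ℕ
  key (I , j , _) = I , j

  contains : ℕ → Entry → Bool
  contains i e = any (_≡ᵇ i) (seqOf e)

  covers : ℕ → Entry → Bool
  covers t e = (suc (startOf e) ≤ᵇ t) ∧ (t ≤ᵇ startOf e + length (seqOf e))

  sumWhere : (Entry → Bool) → List Entry → ℚ
  sumWhere p = sumℚ (λ e → if p e then weight e else 0ℚ)

module Submission where

-- Put x_{i,s} on the node (i, s) of the grid items × slots and draw a step
-- (i, s) → (n(i), s+1) when n(i) ≤ s+1 ≤ k+n.  Nodes have at most one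
-- successor and, n(·) being injective, at most one predecessor, so the grid
-- splits into staircase paths whose items are monochromatic chains.  By the
-- third family of constraints the increments W(v) = x(v) - x(pred v) are
-- nonnegative, and they telescope: x(v) = Σ { W(u) | v is on the path from u }.
-- The path from u = (i, s), started at time s-1, is an MSM of weight W(u).
-- Summing the telescoping identity over a row of the grid gives (a), over a
-- column gives (b), and over the path ends gives (c).

open import Defs
open import Algebra.Bundles using (CommutativeMonoid)
open import Algebra.Properties.CommutativeSemigroup using (interchange)
open import Data.Bool using (Bool; true; false; if_then_else_; T)
open import Data.Bool.Properties using (T-≡; T-∧)
open import Data.Empty using (⊥-elim)
open import Data.List using (List; []; _∷_; map; upTo; applyUpTo; length; last; _++_; cartesianProduct; filter)
open import Data.List.Properties using (map-upTo; last-map; length-map; map-∘; ∷-injectiveˡ; ∷-injectiveʳ)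
open import Data.List.Membership.Propositional using (_∈_; find; lose)
open import Data.List.Membership.Propositional.Properties
  using (∈-map⁺; ∈-map⁻; ∈-filter⁺; ∈-filter⁻; ∈-cartesianProduct⁺; ∈-cartesianProduct⁻; ∈-upTo⁺)
open import Data.List.Relation.Unary.All as All using (All; []; _∷_)
open import Data.List.Relation.Unary.All.Properties as AllP using (All¬⇒¬Any)
open import Data.List.Relation.Unary.Any using (Any; here; there; any?)
open import Data.List.Relation.Unary.Any.Properties using (any⁺; any⁻)
open import Data.List.Relation.Unary.AllPairs using ([]; _∷_)
open import Data.List.Relation.Unary.Unique.Propositional using (Unique)
open import Data.List.Relation.Unary.Unique.Propositional.Properties as Unique using ()
open import Data.Maybe as Maybe using (Maybe; just; nothing; maybe′)
open import Data.Maybe.Properties as MaybeP using ()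
open import Data.Nat using (ℕ; zero; suc; _+_; _∸_; _≤_; _<_; _≡ᵇ_; _≤ᵇ_; _⊔_; _⊓_; z≤n; s≤s)
open import Data.Nat.Properties as ℕ using ()
open import Data.Product using (_×_; _,_; Σ; ∃; proj₁; proj₂)
open import Data.Product.Properties as ProductP using ()
open import Data.Rational using (ℚ; 0ℚ; 1ℚ; -_; _-_) renaming (_+_ to _+ℚ_; _≤_ to _≤ℚ_; _<_ to _<ℚ_)
open import Data.Rational.Properties as ℚ using ()
open import Data.Sum as Sum using (_⊎_; inj₁; inj₂)
open import Data.Unit using (tt)
open import Function using (_∘_; _⇔_; mk⇔; Equivalence)
open import Relation.Binary.PropositionalEquality using (_≡_; _≢_; refl; sym; trans; cong; cong₂; subst; module ≡-Reasoning)
open import Relation.Binary.Definitions using (tri<; tri≈; tri>)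
open import Relation.Nullary using (¬_; Dec; yes; no; does; _×-dec_)

private variable
  A B : Set

sum-map : (f : B → ℚ) (g : A → B) (l : List A) → sumℚ f (map g l) ≡ sumℚ (f ∘ g) l
sum-map f g []      = refl
sum-map f g (a ∷ l) = cong (f (g a) +ℚ_) (sum-map f g l)

sum-cong : {f g : A → ℚ} (l : List A) → (∀ {a} → a ∈ l → f a ≡ g a) → sumℚ f l ≡ sumℚ g l
sum-cong []      eq = refl
sum-cong (a ∷ l) eq = cong₂ _+ℚ_ (eq (here refl)) (sum-cong l (eq ∘ there))

sum-zero : {f : A → ℚ} (l : List A) → (∀ {a} → a ∈ l → f a ≡ 0ℚ) → sumℚ f l ≡ 0ℚ
sum-zero []      eq = refl
sum-zero (a ∷ l) eq = cong₂ _+ℚ_ (eq (here refl)) (sum-zero l (eq ∘ there))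

sum-++ : (f : A → ℚ) (l m : List A) → sumℚ f (l ++ m) ≡ sumℚ f l +ℚ sumℚ f m
sum-++ f []      m = sym (ℚ.+-identityˡ _)
sum-++ f (a ∷ l) m = trans (cong (f a +ℚ_) (sum-++ f l m)) (sym (ℚ.+-assoc (f a) _ _))

sum-window : (h g : A → ℚ) (l₁ l₂ l₃ : List A) →
  (∀ {a} → a ∈ l₁ → h a ≡ 0ℚ) → (∀ {a} → a ∈ l₂ → h a ≡ g a) → (∀ {a} → a ∈ l₃ → h a ≡ 0ℚ) →
  sumℚ h (l₁ ++ l₂ ++ l₃) ≡ sumℚ g l₂
sum-window h g l₁ l₂ l₃ left middle right = begin
  sumℚ h (l₁ ++ l₂ ++ l₃)               ≡⟨ sum-++ h l₁ (l₂ ++ l₃) ⟩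
  sumℚ h l₁ +ℚ sumℚ h (l₂ ++ l₃)        ≡⟨ cong₂ _+ℚ_ (sum-zero l₁ left) (sum-++ h l₂ l₃) ⟩
  0ℚ +ℚ (sumℚ h l₂ +ℚ sumℚ h l₃)        ≡⟨ ℚ.+-identityˡ _ ⟩
  sumℚ h l₂ +ℚ sumℚ h l₃                ≡⟨ cong₂ _+ℚ_ (sum-cong l₂ middle) (sum-zero l₃ right) ⟩
  sumℚ g l₂ +ℚ 0ℚ                       ≡⟨ ℚ.+-identityʳ _ ⟩
  sumℚ g l₂                             ∎
  where open ≡-Reasoning

sum-+ : (f g : A → ℚ) (l : List A) → sumℚ (λ a → f a +ℚ g a) l ≡ sumℚ f l +ℚ sumℚ g l
sum-+ f g []      = refl
sum-+ f g (a ∷ l) = trans (cong ((f a +ℚ g a) +ℚ_) (sum-+ f g l))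
                          (interchange (CommutativeMonoid.commutativeSemigroup ℚ.+-0-commutativeMonoid) (f a) (g a) _ _)

sum-exchange : (g : A → B → ℚ) (l : List A) (m : List B) →
  sumℚ (λ a → sumℚ (g a) m) l ≡ sumℚ (λ b → sumℚ (λ a → g a b) l) m
sum-exchange g []      m = sym (sum-zero m (λ _ → refl))
sum-exchange g (a ∷ l) m = trans (cong (sumℚ (g a) m +ℚ_) (sum-exchange g l m))
                                 (sym (sum-+ (g a) (λ b → sumℚ (λ a → g a b) l) m))

sum-cartesian : (f : A × B → ℚ) (l : List A) (m : List B) →
  sumℚ f (cartesianProduct l m) ≡ sumℚ (λ a → sumℚ (λ b → f (a , b)) m) l
sum-cartesian f []      m = refl
sum-cartesian f (a ∷ l) m = trans (sum-++ f (map (a ,_) m) _)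
                                  (cong₂ _+ℚ_ (sum-map f (a ,_) m) (sum-cartesian f l m))

sum-single : {f : A → ℚ} (l : List A) → Unique l → {a : A} → a ∈ l →
  (∀ {b} → b ∈ l → b ≢ a → f b ≡ 0ℚ) → sumℚ f l ≡ f a
sum-single {f = f} (b ∷ l) (b∉l ∷ _) (here refl) off = begin
  f b +ℚ sumℚ f l ≡⟨ cong (f b +ℚ_) (sum-zero l (λ c∈l → off (there c∈l) (λ { refl → All¬⇒¬Any b∉l c∈l }))) ⟩
  f b +ℚ 0ℚ       ≡⟨ ℚ.+-identityʳ (f b) ⟩
  f b             ∎
  where open ≡-Reasoning
sum-single {f = f} (b ∷ l) (b∉l ∷ u) (there a∈l) off = begin
  f b +ℚ sumℚ f l ≡⟨ cong₂ _+ℚ_ (off (here refl) (λ { refl → All¬⇒¬Any b∉l a∈l }))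
                                (sum-single l u a∈l (off ∘ there)) ⟩
  0ℚ +ℚ f _       ≡⟨ ℚ.+-identityˡ _ ⟩
  f _             ∎
  where open ≡-Reasoning

sum-filter : {P : A → Set} (P? : ∀ a → Dec (P a)) (f : A → ℚ) (l : List A) →
  sumℚ f (filter P? l) ≡ sumℚ (λ a → if does (P? a) then f a else 0ℚ) l
sum-filter P? f []      = refl
sum-filter P? f (a ∷ l) with does (P? a)
... | true  = cong (f a +ℚ_) (sum-filter P? f l)
... | false = trans (sum-filter P? f l) (sym (ℚ.+-identityˡ _))

indicator : (b : Bool) {w v : ℚ} → (T b → w ≡ v) → (¬ T b → 0ℚ ≡ v) → (if b then w else 0ℚ) ≡ v
indicator true  on off = on tt
indicator false on off = off (λ ())

indicator-zero : (b : Bool) {w : ℚ} → w ≡ 0ℚ → (if b then w else 0ℚ) ≡ 0ℚ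
indicator-zero b w≡0 = indicator b (λ _ → w≡0) (λ _ → refl)

dec-on : {P : Set} (d : Dec P) {w : ℚ} → P → (if does d then w else 0ℚ) ≡ w
dec-on (yes _) p = refl
dec-on (no ¬p) p = ⊥-elim (¬p p)

dec-off : {P : Set} (d : Dec P) {w : ℚ} → ¬ P → (if does d then w else 0ℚ) ≡ 0ℚ
dec-off (yes p) ¬p = ⊥-elim (¬p p)
dec-off (no _)  ¬p = refl

dec-cong : {P Q : Set} (d : Dec P) (d′ : Dec Q) {w : ℚ} → P ⇔ Q →
  (if does d then w else 0ℚ) ≡ (if does d′ then w else 0ℚ)
dec-cong (yes p) d′ p⇔q = sym (dec-on d′ (Equivalence.to p⇔q p))
dec-cong (no ¬p) d′ p⇔q = sym (dec-off d′ (¬p ∘ Equivalence.from p⇔q))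

dec-drop : {P : Set} (d : Dec P) {w : ℚ} → (¬ P → w ≡ 0ℚ) → (if does d then w else 0ℚ) ≡ w
dec-drop (yes _) _   = refl
dec-drop (no ¬p) w≡0 = sym (w≡0 ¬p)

minus-+ : ∀ p q → (p - q) +ℚ q ≡ p
minus-+ p q = trans (ℚ.+-assoc p (- q) q) (trans (cong (p +ℚ_) (ℚ.+-inverseˡ q)) (ℚ.+-identityʳ p))

minus-nonneg : ∀ {p q} → q ≤ℚ p → 0ℚ ≤ℚ p - q
minus-nonneg {p} {q} q≤p = subst (_≤ℚ p - q) (ℚ.+-inverseʳ q) (ℚ.+-monoˡ-≤ (- q) q≤p)

minus-≤ : ∀ {p q} → 0ℚ ≤ℚ q → p - q ≤ℚ p
minus-≤ {p} {q} 0≤q = subst (p - q ≤ℚ_) (ℚ.+-identityʳ p) (ℚ.+-monoʳ-≤ p (ℚ.neg-antimono-≤ 0≤q))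

last-∈ : ∀ (l : List A) {v} → last l ≡ just v → v ∈ l
last-∈ (a ∷ [])    refl = here refl
last-∈ (a ∷ b ∷ l) lst  = there (last-∈ (b ∷ l) lst)

last-item : ∀ (l : List (A × B)) {v} → last l ≡ just v → last (map proj₁ l) ≡ just (proj₁ v)
last-item l lst = trans (last-map proj₁ l) (cong (Maybe.map proj₁) lst)

map-unique : (f : A → B) {l : List A} → (∀ {a a′} → a ∈ l → a′ ∈ l → f a ≡ f a′ → a ≡ a′) →
  Unique l → Unique (map f l)
map-unique f inj []          = []
map-unique f inj (a∉ ∷ uniq) =
  AllP.map⁺ (All.tabulate (λ a′∈ fa≡fa′ → All.lookup a∉ a′∈ (inj (here refl) (there a′∈) fa≡fa′)))
  ∷ map-unique f (λ a∈ a′∈ → inj (there a∈) (there a′∈)) uniq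

range : ℕ → ℕ → List ℕ
range a zero    = []
range a (suc m) = a ∷ range (suc a) m

applyUpTo-range : (f : ℕ → ℕ) (a m : ℕ) → (∀ i → f i ≡ a + i) → applyUpTo f m ≡ range a m
applyUpTo-range f a zero    f≡ = refl
applyUpTo-range f a (suc m) f≡ = cong₂ _∷_ (trans (f≡ 0) (ℕ.+-identityʳ a))
  (applyUpTo-range (f ∘ suc) (suc a) m (λ i → trans (f≡ (suc i)) (ℕ.+-suc a i)))

interval-range : ∀ a b → interval a b ≡ range a (suc b ∸ a)
interval-range a b = trans (map-upTo (a +_) (suc b ∸ a)) (applyUpTo-range (a +_) a _ (λ _ → refl))

range-++ : ∀ a p q → range a (p + q) ≡ range a p ++ range (a + p) q
range-++ a zero    q = cong (λ b → range b q) (sym (ℕ.+-identityʳ a))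
range-++ a (suc p) q = cong (a ∷_) (trans (range-++ (suc a) p q)
                                          (cong (λ b → range (suc a) p ++ range b q) (sym (ℕ.+-suc a p))))

∈-range⁻ : ∀ {a m x} → x ∈ range a m → a ≤ x × x < a + m
∈-range⁻ {a} {suc m} (here refl) = ℕ.≤-refl , ℕ.m<m+n a (s≤s z≤n)
∈-range⁻ {a} {suc m} {x} (there x∈) with ∈-range⁻ x∈
... | a<x , x< = ℕ.<⇒≤ a<x , subst (x <_) (sym (ℕ.+-suc a m)) x<

∈-range⁺ : ∀ {a m x} → a ≤ x → x < a + m → x ∈ range a m
∈-range⁺ {a} {zero}      a≤x x< = ⊥-elim (ℕ.<-irrefl refl (ℕ.<-≤-trans x< (subst (_≤ _) (sym (ℕ.+-identityʳ a)) a≤x)))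
∈-range⁺ {a} {suc m} {x} a≤x x< with a ℕ.≟ x
... | yes refl = here refl
... | no a≢x   = there (∈-range⁺ (ℕ.≤∧≢⇒< a≤x a≢x) (subst (x <_) (ℕ.+-suc a m) x<))

range-unique : ∀ a m → Unique (range a m)
range-unique a zero    = []
range-unique a (suc m) = All.tabulate (λ x∈ a≡x → ℕ.<-irrefl a≡x (proj₁ (∈-range⁻ x∈))) ∷ range-unique (suc a) m

last-range : ∀ a m → last (range a (suc m)) ≡ just (a + m)
last-range a zero    = cong just (sym (ℕ.+-identityʳ a))
last-range a (suc m) = trans (last-range (suc a) m) (cong just (sym (ℕ.+-suc a m)))

span : ℕ → ℕ → List ℕ
span a e = range a (e ∸ a)

∈-span⁻ : ∀ {a e x} → a ≤ e → x ∈ span a e → a ≤ x × x < e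
∈-span⁻ {x = x} a≤e x∈ = let a≤x , x< = ∈-range⁻ x∈ in a≤x , subst (x <_) (ℕ.m+[n∸m]≡n a≤e) x<

span-++ : ∀ {a m e} → a ≤ m → m ≤ e → span a e ≡ span a m ++ span m e
span-++ {a} a≤m m≤e with ℕ.m≤n⇒∃[o]m+o≡n a≤m | ℕ.m≤n⇒∃[o]m+o≡n m≤e
... | p , refl | q , refl = begin
  range a (a + p + q ∸ a)                    ≡⟨ cong (λ l → range a (l ∸ a)) (ℕ.+-assoc a p q) ⟩
  range a (a + (p + q) ∸ a)                  ≡⟨ cong (range a) (ℕ.m+n∸m≡n a (p + q)) ⟩
  range a (p + q)                            ≡⟨ range-++ a p q ⟩
  range a p ++ range (a + p) q               ≡⟨ sym (cong₂ (λ p′ q′ → range a p′ ++ range (a + p) q′)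
                                                           (ℕ.m+n∸m≡n a p) (ℕ.m+n∸m≡n (a + p) q)) ⟩
  span a (a + p) ++ span (a + p) (a + p + q) ∎
  where open ≡-Reasoning

+-∸-⊔ : ∀ a m → a + (m ∸ a) ≡ a ⊔ m
+-∸-⊔ a m with ℕ.≤-total a m
... | inj₁ a≤m = trans (ℕ.m+[n∸m]≡n a≤m) (sym (ℕ.m≤n⇒m⊔n≡n a≤m))
... | inj₂ m≤a = trans (cong (a +_) (ℕ.m≤n⇒m∸n≡0 m≤a)) (trans (ℕ.+-identityʳ a) (sym (ℕ.m≥n⇒m⊔n≡m m≤a)))

∈-interval⁻ : ∀ {a b x} → x ∈ interval a b → a ≤ x × x ≤ b
∈-interval⁻ {a} {b} {x} x∈ with ∈-range⁻ (subst (_ ∈_) (interval-range a b) x∈)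
... | a≤x , x< with ℕ.⊔-sel a (suc b)
...   | inj₁ ⊔≡a = ⊥-elim (ℕ.<-irrefl refl (ℕ.<-≤-trans (subst (x <_) (trans (+-∸-⊔ a (suc b)) ⊔≡a) x<) a≤x))
...   | inj₂ ⊔≡b = a≤x , ℕ.≤-pred (subst (x <_) (trans (+-∸-⊔ a (suc b)) ⊔≡b) x<)

∈-interval⁺ : ∀ {a b x} → a ≤ x → x ≤ b → x ∈ interval a b
∈-interval⁺ {a} {b} {x} a≤x x≤b = subst (_ ∈_) (sym (interval-range a b))
  (∈-range⁺ a≤x (subst (x <_) (sym (+-∸-⊔ a (suc b))) (ℕ.m≤n⇒m≤o⊔n a (s≤s x≤b))))

interval-span : ∀ a b → interval a b ≡ span a (a ⊔ suc b)
interval-span a b = trans (interval-range a b) (cong (range a) (sym (begin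
  a ⊔ suc b ∸ a              ≡⟨ cong (_∸ a) (sym (+-∸-⊔ a (suc b))) ⟩
  a + (suc b ∸ a) ∸ a        ≡⟨ ℕ.m+n∸m≡n a (suc b ∸ a) ⟩
  suc b ∸ a                  ∎)))
  where open ≡-Reasoning

interval-unique : ∀ a b → Unique (interval a b)
interval-unique a b = subst Unique (sym (interval-range a b)) (range-unique a _)

-- A sum over [A, B] of a summand supported on [a, b] ⊆ [A, B] is the sum
-- over [a, b]; a ≤ B+1 allows [a, b] to be empty.
sum-subinterval : (h g : ℕ → ℚ) {A B a b : ℕ} → A ≤ a → b ≤ B → a ≤ suc B →
  (∀ {j} → a ≤ j → j ≤ b → h j ≡ g j) →
  (∀ {j} → A ≤ j → j ≤ B → j < a ⊎ b < j → h j ≡ 0ℚ) →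
  sumℚ h (interval A B) ≡ Σ[ a , b ] g
sum-subinterval h g {A} {B} {a} {b} A≤a b≤B a≤1+B inside outside =
  trans (cong (sumℚ h) cut) (sum-window h g _ _ _ left middle right)
  where
  open ≡-Reasoning
  e = a ⊔ suc b
  a≤e : a ≤ e
  a≤e = ℕ.m≤m⊔n a (suc b)
  e≤1+B : e ≤ suc B
  e≤1+B = ℕ.⊔-lub a≤1+B (s≤s b≤B)
  cut : interval A B ≡ span A a ++ interval a b ++ span e (suc B)
  cut = begin
    interval A B                                  ≡⟨ interval-range A B ⟩
    span A (suc B)                                ≡⟨ span-++ A≤a (ℕ.≤-trans a≤e e≤1+B) ⟩
    span A a ++ span a (suc B)                    ≡⟨ cong (span A a ++_) (span-++ a≤e e≤1+B) ⟩
    span A a ++ span a e ++ span e (suc B)        ≡⟨ cong (λ l → span A a ++ l ++ span e (suc B)) (sym (interval-span a b)) ⟩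
    span A a ++ interval a b ++ span e (suc B)    ∎
  left : ∀ {j} → j ∈ span A a → h j ≡ 0ℚ
  left j∈ = let A≤j , j<a = ∈-span⁻ A≤a j∈ in outside A≤j (ℕ.≤-pred (ℕ.≤-trans j<a a≤1+B)) (inj₁ j<a)
  middle : ∀ {j} → j ∈ interval a b → h j ≡ g j
  middle j∈ = let a≤j , j≤b = ∈-interval⁻ j∈ in inside a≤j j≤b
  right : ∀ {j} → j ∈ span e (suc B) → h j ≡ 0ℚ
  right j∈ = let e≤j , j<1+B = ∈-span⁻ e≤1+B j∈ in
    outside (ℕ.≤-trans A≤a (ℕ.≤-trans a≤e e≤j)) (ℕ.≤-pred j<1+B) (inj₂ (ℕ.m⊔n≤o⇒n≤o a (suc b) e≤j))

module NextItem (k n : ℕ) (c : ℕ → ℕ) where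
  open Instance k n c

  search-sound : ∀ col s f {r} → search col s f ≡ just r → c r ≡ col × s ≤ r × r < s + f
  search-sound col s zero ()
  search-sound col s (suc f) found with c s ≡ᵇ col in eq
  search-sound col s (suc f) refl | true = ℕ.≡ᵇ⇒≡ _ _ (Equivalence.from T-≡ eq) , ℕ.≤-refl , ℕ.m<m+n s (s≤s z≤n)
  search-sound col s (suc f) {r} found | false with search-sound col (suc s) f found
  ... | cr , s<r , r< = cr , ℕ.<⇒≤ s<r , subst (r <_) (sym (ℕ.+-suc s f)) r<

  search-first : ∀ col s f {r m} → search col s f ≡ just r → s ≤ m → m < r → c m ≢ col
  search-first col s zero () s≤m m<r
  search-first col s (suc f) {m = m} found s≤m m<r with c s ≡ᵇ col in eq
  search-first col s (suc f) refl s≤m m<r | true = ⊥-elim (ℕ.<-irrefl refl (ℕ.<-≤-trans m<r s≤m))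
  ... | false with s ℕ.≟ m
  ...   | yes refl = λ cs≡col → subst T eq (ℕ.≡⇒≡ᵇ _ _ cs≡col)
  ...   | no s≢m   = search-first col (suc s) f found (ℕ.≤∧≢⇒< s≤m s≢m) m<r

  nxt-just : ∀ {i b} → nextM i ≡ just b → nxt i ≡ b
  nxt-just {i} found with nextM i
  nxt-just refl | just _ = refl

  nextM-bounds : ∀ {i b} → nextM i ≡ just b → i < b × b ≤ n × c b ≡ c i
  nextM-bounds {i} {b} found with search-sound (c i) (suc i) (n ∸ i) found
  ... | cb , i<b , b< with i ℕ.≤? n
  ...   | yes i≤n = i<b , ℕ.≤-pred (subst (b <_) (cong suc (ℕ.m+[n∸m]≡n i≤n)) b<) , cb
  ...   | no  i≰n = ⊥-elim (ℕ.<-irrefl refl (ℕ.<-≤-trans b< (subst (_≤ b) (sym i+0) i<b)))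
    where
    i+0 : suc i + (n ∸ i) ≡ suc i
    i+0 = trans (cong (suc i +_) (ℕ.m≤n⇒m∸n≡0 (ℕ.<⇒≤ (ℕ.≰⇒> i≰n)))) (ℕ.+-identityʳ (suc i))

  -- an earlier item with next item b would have met the later one, of the same colour, first
  nextM-earlier : ∀ {a a′ b} → nextM a ≡ just b → nextM a′ ≡ just b → ¬ a < a′
  nextM-earlier {a} found found′ a<a′ =
    let _ , _ , cb≡ca = nextM-bounds found ; a′<b , _ , cb≡ca′ = nextM-bounds found′
    in search-first (c a) (suc a) (n ∸ a) found a<a′ a′<b (trans (sym cb≡ca′) cb≡ca)

  nextM-injective : ∀ {a a′ b} → nextM a ≡ just b → nextM a′ ≡ just b → a ≡ a′
  nextM-injective {a} {a′} found found′ with ℕ.<-cmp a a′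
  ... | tri< a<a′ _ _ = ⊥-elim (nextM-earlier found found′ a<a′)
  ... | tri≈ _ a≡a′ _ = a≡a′
  ... | tri> _ _ a′<a = ⊥-elim (nextM-earlier found′ found a′<a)

  nxt-small : ∀ i → nxt i ≤ suc (k + n) → nextM i ≡ just (nxt i)
  nxt-small i small with nextM i
  ... | just b  = refl
  ... | nothing = ⊥-elim (ℕ.<-irrefl refl (ℕ.≤-trans (ℕ.≤-reflexive (ℕ.+-comm 2 (k + n))) small))

  nxt-bound : ∀ i → nxt i ≤ k + n + 2
  nxt-bound i with nextM i in found
  ... | just b  = ℕ.≤-trans (proj₁ (proj₂ (nextM-bounds {i} found))) (ℕ.≤-trans (ℕ.m≤n+m n k) (ℕ.m≤m+n (k + n) 2))
  ... | nothing = ℕ.≤-refl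

-- A measure μ that
-- strictly decreases along next bounds the fuel needed to reach its end.

module Orbit {A : Set} (next : A → Maybe A) (μ : A → ℕ)
             (μ-decreases : ∀ {u w} → next u ≡ just w → μ w < μ u) where

  orbit : ℕ → A → List A
  orbit zero    u = u ∷ []
  orbit (suc f) u = u ∷ maybe′ (orbit f) [] (next u)

  orbit-head : ∀ f u → ∃ λ l → orbit f u ≡ u ∷ l
  orbit-head zero    u = [] , refl
  orbit-head (suc f) u = _ , refl

  start∈orbit : ∀ f u → u ∈ orbit f u
  start∈orbit zero    u = here refl
  start∈orbit (suc f) u = here refl

  orbit-invariant : {P : A → Set} → (∀ {v w} → P v → next v ≡ just w → P w) →
    ∀ f {u} → P u → All P (orbit f u)
  orbit-invariant pres zero    Pu = Pu ∷ []
  orbit-invariant pres (suc f) {u} Pu with next u in step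
  ... | nothing = Pu ∷ []
  ... | just w  = Pu ∷ orbit-invariant pres f (pres Pu step)

  orbit-pred : ∀ f {u v} → v ∈ orbit f u → v ≡ u ⊎ ∃ λ w → w ∈ orbit f u × next w ≡ just v
  orbit-pred zero    (here refl) = inj₁ refl
  orbit-pred (suc f) (here refl) = inj₁ refl
  orbit-pred (suc f) {u} (there v∈) with next u in step
  ... | just w with orbit-pred f v∈
  ...   | inj₁ refl             = inj₂ (u , here refl , step)
  ...   | inj₂ (w′ , w′∈ , step′) = inj₂ (w′ , there w′∈ , step′)

  orbit-end-unique : ∀ f {u v v′} → v ∈ orbit f u → v′ ∈ orbit f u →
    next v ≡ nothing → next v′ ≡ nothing → v ≡ v′
  orbit-end-unique zero    (here refl) (here refl) end end′ = refl
  orbit-end-unique (suc f) {u} v∈ v′∈ end end′ with next u in step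
  orbit-end-unique (suc f) (here refl) (here refl) end end′ | _ = refl
  orbit-end-unique (suc f) (here refl) (there _)   end end′ | just w with () ← trans (sym end) step
  orbit-end-unique (suc f) (there _)   (here refl) end end′ | just w with () ← trans (sym end′) step
  orbit-end-unique (suc f) (there v∈)  (there v′∈) end end′ | just w = orbit-end-unique f v∈ v′∈ end end′

  module Ordered {R : A → A → Set} (R-trans : ∀ {u v w} → R u v → R v w → R u w)
               (R-step : ∀ {v w} → next v ≡ just w → R v w) where

    orbit-after : ∀ f {u v} → v ∈ orbit f u → v ≡ u ⊎ R u v
    orbit-after zero    (here refl) = inj₁ refl
    orbit-after (suc f) (here refl) = inj₁ refl
    orbit-after (suc f) {u} (there v∈) with next u in step
    ... | just w with orbit-after f v∈
    ...   | inj₁ refl = inj₂ (R-step step)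
    ...   | inj₂ Rwv  = inj₂ (R-trans (R-step step) Rwv)

    orbit-comparable : ∀ f {u v v′} → v ∈ orbit f u → v′ ∈ orbit f u → v ≡ v′ ⊎ R v v′ ⊎ R v′ v
    orbit-comparable zero    (here refl) (here refl) = inj₁ refl
    orbit-comparable (suc f) (here refl) v′∈ with orbit-after (suc f) v′∈
    ... | inj₁ refl = inj₁ refl
    ... | inj₂ Ruv′ = inj₂ (inj₁ Ruv′)
    orbit-comparable (suc f) (there v∈) (here refl) with orbit-after (suc f) (there v∈)
    ... | inj₁ refl = inj₁ refl
    ... | inj₂ Ruv  = inj₂ (inj₂ Ruv)
    orbit-comparable (suc f) {u} (there v∈) (there v′∈) with next u
    ... | just w = orbit-comparable f v∈ v′∈

  fuel-step : ∀ {f u w} → μ u ≤ suc f → next u ≡ just w → μ w ≤ f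
  fuel-step μu≤ step = ℕ.≤-pred (ℕ.<-≤-trans (μ-decreases step) μu≤)

  fuel-exhausted : ∀ {u} → μ u ≤ 0 → next u ≡ nothing
  fuel-exhausted {u} μu≤0 with next u in step
  ... | nothing = refl
  ... | just w  = ⊥-elim (ℕ.n≮0 (ℕ.<-≤-trans (μ-decreases step) μu≤0))

  orbit-closed : ∀ f {u v w} → μ u ≤ f → w ∈ orbit f u → next w ≡ just v → v ∈ orbit f u
  orbit-closed zero    μu≤0 (here refl) step with () ← trans (sym (fuel-exhausted μu≤0)) step
  orbit-closed (suc f) {u} μu≤ (here refl) step with next u
  orbit-closed (suc f) μu≤ (here refl) refl | just v = there (start∈orbit f v)
  orbit-closed (suc f) {u} μu≤ (there w∈) step with next u in step′
  ... | just w = there (orbit-closed f (fuel-step μu≤ step′) w∈ step)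

  orbit-last : ∀ f {u} → μ u ≤ f → ∃ λ v → last (orbit f u) ≡ just v × next v ≡ nothing
  orbit-last zero    {u} μu≤0 = u , refl , fuel-exhausted μu≤0
  orbit-last (suc f) {u} μu≤ with next u in step
  ... | nothing = u , refl , step
  ... | just w with orbit-head f w | orbit-last f (fuel-step μu≤ step)
  ...   | l , eq | v , lst , end =
    v , subst (λ l′ → last (u ∷ l′) ≡ just v) (sym eq) (subst (λ l′ → last l′ ≡ just v) eq lst) , end

module Staircase (k n : ℕ) (c : ℕ → ℕ) where
  open Instance k n c
  open NextItem k n c

  Node : Set
  Node = ℕ × ℕ

  _≟ₙ_ : (u v : Node) → Dec (u ≡ v)
  _≟ₙ_ = ProductP.≡-dec ℕ._≟_ ℕ._≟_

  InGrid : Node → Set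
  InGrid (a , s) = IsItem a × suc k ≤ s × s ≤ k + n

  inGrid? : ∀ v → Dec (InGrid v)
  inGrid? (a , s) = ((1 ℕ.≤? a) ×-dec (a ℕ.≤? n)) ×-dec ((suc k ℕ.≤? s) ×-dec (s ℕ.≤? k + n))

  Linked : ℕ → ℕ → Set
  Linked a s = nxt a ≤ suc s × suc s ≤ k + n

  linked? : ∀ a s → Dec (Linked a s)
  linked? a s = (nxt a ℕ.≤? suc s) ×-dec (suc s ℕ.≤? k + n)

  step : Node → Maybe Node
  step (a , s) with linked? a s
  ... | yes _ = just (nxt a , suc s)
  ... | no  _ = nothing

  step-linked : ∀ {a s} → Linked a s → step (a , s) ≡ just (nxt a , suc s)
  step-linked {a} {s} l with linked? a s
  ... | yes _ = refl
  ... | no ¬l = ⊥-elim (¬l l)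

  step-end : ∀ {a s} → step (a , s) ≡ nothing → ¬ Linked a s
  step-end {a} {s} end with linked? a s
  step-end () | yes _
  ... | no ¬l = ¬l

  step-unlinked : ∀ {a s} → ¬ Linked a s → step (a , s) ≡ nothing
  step-unlinked {a} {s} ¬l with linked? a s
  ... | yes l = ⊥-elim (¬l l)
  ... | no _  = refl

  record Step (a s b t : ℕ) : Set where
    field
      next-item : nextM a ≡ just b
      next-slot : t ≡ suc s
      item≤slot : b ≤ t
      in-range  : t ≤ k + n

  step-sound : ∀ {a s b t} → step (a , s) ≡ just (b , t) → Step a s b t
  step-sound {a} {s} st with linked? a s
  step-sound {a} refl | yes (n≤ , ≤k+n) = record
    { next-item = nxt-small a (ℕ.≤-trans n≤ (ℕ.m≤n⇒m≤1+n ≤k+n))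
    ; next-slot = refl ; item≤slot = n≤ ; in-range = ≤k+n }

  step-grid : ∀ {v w} → InGrid v → step v ≡ just w → InGrid w
  step-grid {a , s} (_ , k<s , _) st with step-sound st
  ... | record { next-item = nb ; next-slot = refl ; in-range = ≤k+n } =
    let a<b , b≤n , _ = nextM-bounds {a} nb in (ℕ.≤-trans (s≤s z≤n) a<b , b≤n) , ℕ.m≤n⇒m≤1+n k<s , ≤k+n

  Ahead : Node → Node → Set
  Ahead (a , s) (b , t) = a < b × s < t

  ahead-trans : ∀ {u v w} → Ahead u v → Ahead v w → Ahead u w
  ahead-trans (a<b , s<t) (b<c , t<r) = ℕ.<-trans a<b b<c , ℕ.<-trans s<t t<r

  step-ahead : ∀ {v w} → step v ≡ just w → Ahead v w
  step-ahead st with step-sound st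
  ... | record { next-item = nb ; next-slot = refl } = proj₁ (nextM-bounds nb) , ℕ.≤-refl

  slots-left : Node → ℕ
  slots-left (_ , s) = k + n ∸ s

  step-slots-left : ∀ {v w} → step v ≡ just w → slots-left w < slots-left v
  step-slots-left {a , s} st with step-sound st
  ... | record { next-slot = refl ; in-range = ≤k+n } = ℕ.∸-monoʳ-< (ℕ.n<1+n s) ≤k+n

  previous? : ∀ b → Dec (Any (λ a → nextM a ≡ just b) (upTo b))
  previous? b = any? (λ a → MaybeP.≡-dec ℕ._≟_ (nextM a) (just b)) (upTo b)

  previous : ℕ → Maybe ℕ
  previous b with previous? b
  ... | yes found = just (proj₁ (find found))
  ... | no  _     = nothing

  previous-sound : ∀ {a b} → previous b ≡ just a → nextM a ≡ just b
  previous-sound {b = b} prev with previous? b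
  previous-sound refl | yes found = proj₂ (proj₂ (find found))

  previous-complete : ∀ {a b} → nextM a ≡ just b → previous b ≡ just a
  previous-complete {a} {b} nb with previous? b
  ... | yes found = cong just (nextM-injective (proj₂ (proj₂ (find found))) nb)
  ... | no  none  = ⊥-elim (none (lose (∈-upTo⁺ (proj₁ (nextM-bounds {a} nb))) nb))

  back : Node → Maybe Node
  back (b , zero)  = nothing
  back (b , suc t) with previous b
  ... | nothing = nothing
  ... | just a with linked? a t
  ...   | yes _ = just (a , t)
  ...   | no  _ = nothing

  back-step : ∀ {v w} → back v ≡ just w → step w ≡ just v
  back-step {b , suc t} bk with previous b in prev
  ... | just a with linked? a t
  back-step {b , suc t} refl | just a | yes l =
    trans (step-linked l) (cong (λ i → just (i , suc t)) (nxt-just {a} (previous-sound prev)))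

  back-linked : ∀ {a b t} → previous b ≡ just a → Linked a t → back (b , suc t) ≡ just (a , t)
  back-linked {a} {b} {t} prev l rewrite prev with linked? a t
  ... | yes _ = refl
  ... | no ¬l = ⊥-elim (¬l l)

  step-back : ∀ {v w} → step w ≡ just v → back v ≡ just w
  step-back {b , t} {a , s} st with step-sound st
  ... | record { next-item = nb ; next-slot = refl ; item≤slot = b≤ ; in-range = ≤k+n } =
    back-linked (previous-complete nb) (subst (_≤ suc s) (sym (nxt-just {a} nb)) b≤ , ≤k+n)

  open Orbit step slots-left step-slots-left public
  open Ordered ahead-trans step-ahead public

  path : Node → List Node
  path = orbit (k + n)

  enough-fuel : ∀ u → slots-left u ≤ k + n
  enough-fuel (_ , s) = ℕ.m∸n≤m (k + n) s

  path-grid : ∀ {u} → InGrid u → All InGrid (path u)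
  path-grid = orbit-invariant step-grid (k + n)

  ahead-different : ∀ {v v′} → Ahead v v′ → ¬ (proj₁ v ≡ proj₁ v′ ⊎ proj₂ v ≡ proj₂ v′)
  ahead-different (a< , _) (inj₁ eq) = ℕ.<-irrefl eq a<
  ahead-different (_ , s<) (inj₂ eq) = ℕ.<-irrefl eq s<

  path-same : ∀ {u v v′} → v ∈ path u → v′ ∈ path u → proj₁ v ≡ proj₁ v′ ⊎ proj₂ v ≡ proj₂ v′ → v ≡ v′
  path-same v∈ v′∈ same with orbit-comparable (k + n) v∈ v′∈
  ... | inj₁ v≡v′         = v≡v′
  ... | inj₂ (inj₁ ahead) = ⊥-elim (ahead-different ahead same)
  ... | inj₂ (inj₂ ahead) = ⊥-elim (ahead-different ahead (Sum.map sym sym same))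

  path-no-return : ∀ {u w} → w ∈ path u → step w ≢ just u
  path-no-return {u , s} w∈ st with orbit-after (k + n) w∈
  ... | inj₁ refl   = ℕ.<-irrefl refl (proj₂ (step-ahead st))
  ... | inj₂ (_ , s<) = ℕ.<-irrefl refl (ℕ.<-trans s< (proj₂ (step-ahead st)))

  path-slots : ∀ f a s → map proj₂ (orbit f (a , s)) ≡ range s (length (orbit f (a , s)))
  path-slots zero    a s = refl
  path-slots (suc f) a s with step (a , s) in st
  ... | nothing     = refl
  ... | just (b , t) with step-sound st
  ...   | record { next-slot = refl } = cong (s ∷_) (path-slots f b (suc s))

  path-chain : ∀ f u → Chain (map proj₁ (orbit f u))
  path-chain zero    u = tt
  path-chain (suc f) (a , s) with step (a , s) in st
  ... | nothing = tt
  ... | just (b , t) with step-sound st | orbit-head f (b , t) | path-chain f (b , t)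
  ...   | record { next-item = nb } | l , eq | chain rewrite eq =
    sym (proj₂ (proj₂ (nextM-bounds {a} nb))) , nxt-just {a} nb , chain

  path-end : ∀ a s → ∃ λ v → last (path (a , s)) ≡ just v × step v ≡ nothing × s + length (path (a , s)) ≡ suc (proj₂ v)
  path-end a s with orbit-last (k + n) (enough-fuel (a , s)) | orbit-head (k + n) (a , s)
  ... | v , lst , end | l , eq = v , lst , end , slot
    where
    open ≡-Reasoning
    last-slot : just (proj₂ v) ≡ just (s + length l)
    last-slot = begin
      just (proj₂ v)                          ≡⟨ cong (Maybe.map proj₂) (sym lst) ⟩
      Maybe.map proj₂ (last (path (a , s))) ≡⟨ sym (last-map proj₂ (path (a , s))) ⟩
      last (map proj₂ (path (a , s)))         ≡⟨ cong last (path-slots (k + n) a s) ⟩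
      last (range s (length (path (a , s))))  ≡⟨ cong (λ l′ → last (range s (length l′))) eq ⟩
      last (range s (suc (length l)))         ≡⟨ last-range s (length l) ⟩
      just (s + length l)                     ∎
    slot : s + length (path (a , s)) ≡ suc (proj₂ v)
    slot = trans (cong (λ l′ → s + length l′) eq)
                 (trans (ℕ.+-suc s (length l)) (cong suc (sym (MaybeP.just-injective last-slot))))

  fits-nodes : ∀ j (l : List Node) → map proj₂ l ≡ range (suc j) (length l) →
    All (λ v → proj₁ v ≤ proj₂ v) l → Fits j (map proj₁ l)
  fits-nodes j []            _     []           = tt
  fits-nodes j ((a , s) ∷ l) slots (a≤s ∷ rest) =
    subst (a ≤_) (∷-injectiveˡ slots) a≤s , fits-nodes (suc j) l (∷-injectiveʳ slots) rest

-- Reading x on the nodes,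
-- W(v) = x(v) - x(back v) is the increment of x on arriving at v; it is
-- nonnegative by the third family of LP constraints.  Every u in the grid
-- spreads W(u) over its path (onPath u), and the total cover(v) received by
-- a node v telescopes to x(v).

module Increments (k n : ℕ) (c : ℕ → ℕ) (X : ℕ → ℕ → ℚ) (feasible : Instance.Feasible k n c X) where
  open Instance k n c
  open NextItem k n c
  open Staircase k n c
  open import Data.List.Membership.DecPropositional _≟ₙ_ using (_∈?_)

  item-constraint : ∀ i → IsItem i → Σ[ suc k ⊔ i , k + n ] (λ j → xv X i j) ≡ 1ℚ
  item-constraint = proj₁ feasible

  slot-constraint : ∀ j → suc k ≤ j → j ≤ k + n → Σ[ 1 , j ⊓ n ] (λ i → xv X i j) ≡ 1ℚ
  slot-constraint = proj₁ (proj₂ feasible)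

  chain-constraint : ∀ i → IsItem i → NotLast i → ∀ j → nxt i ≤ j → xv X i (j ∸ 1) ≤ℚ xv X (nxt i) j
  chain-constraint = proj₁ (proj₂ (proj₂ feasible))

  x : Node → ℚ
  x (a , s) = xv X a s

  x-nonneg : ∀ v → 0ℚ ≤ℚ x v
  x-nonneg (a , s) = proj₂ (proj₂ (proj₂ feasible)) a s

  Variable : Node → Set
  Variable (a , s) = InGrid (a , s) × a ≤ s

  inRange-variable : ∀ {a s} → T (inRange a s) → Variable (a , s)
  inRange-variable {a} {s} r
    with 1≤a , r₁ ← Equivalence.to (T-∧ {1 ≤ᵇ a}) r
    with a≤n , r₂ ← Equivalence.to (T-∧ {a ≤ᵇ n}) r₁
    with lo , hi ← Equivalence.to (T-∧ {suc k ⊔ a ≤ᵇ s}) r₂ =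
    let k⊔a≤s = ℕ.≤ᵇ⇒≤ (suc k ⊔ a) s lo in
    ((ℕ.≤ᵇ⇒≤ 1 a 1≤a , ℕ.≤ᵇ⇒≤ a n a≤n) , ℕ.m⊔n≤o⇒m≤o (suc k) a k⊔a≤s , ℕ.≤ᵇ⇒≤ s (k + n) hi)
    , ℕ.m⊔n≤o⇒n≤o (suc k) a k⊔a≤s

  x-nonvariable : ∀ {a s} → ¬ Variable (a , s) → x (a , s) ≡ 0ℚ
  x-nonvariable {a} {s} ¬var with inRange a s in r
  ... | true  = ⊥-elim (¬var (inRange-variable (subst T (sym r) tt)))
  ... | false = refl

  x-positive : ∀ {a s} → 0ℚ <ℚ x (a , s) → Variable (a , s)
  x-positive {a} {s} pos with inRange a s in r
  ... | true  = inRange-variable (subst T (sym r) tt)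
  ... | false = ⊥-elim (ℚ.<-irrefl refl pos)

  x-step : ∀ {v w} → step v ≡ just w → x v ≤ℚ x w
  x-step {a , s} {b , t} st with step-sound st
  ... | record { next-item = nb ; next-slot = refl ; item≤slot = b≤ } with (1 ℕ.≤? a) ×-dec (a ℕ.≤? n)
  ...   | yes item = subst (λ i → xv X a s ≤ℚ xv X i (suc s)) n≡b
                       (chain-constraint a item (b , nb) (suc s) (subst (_≤ suc s) (sym n≡b) b≤))
    where n≡b = nxt-just {a} nb
  ...   | no ¬item = subst (_≤ℚ x (b , suc s)) (sym (x-nonvariable (¬item ∘ proj₁ ∘ proj₁))) (x-nonneg (b , suc s))

  x-horizon : ∀ {a s} → InGrid (a , s) → nxt a ≤ suc s → ¬ suc s ≤ k + n → x (a , s) ≡ 0ℚ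
  x-horizon {a} {s} (item , _ , s≤k+n) n≤ beyond = ℚ.≤-antisym
    (subst (x (a , s) ≤ℚ_) (x-nonvariable (beyond ∘ proj₂ ∘ proj₂ ∘ proj₁))
           (chain-constraint a item (nxt a , nxt-small a (ℕ.≤-trans n≤ (s≤s s≤k+n))) (suc s) n≤))
    (x-nonneg (a , s))

  lift : (Node → ℚ) → Maybe Node → ℚ
  lift f nothing  = 0ℚ
  lift f (just w) = f w

  W : Node → ℚ
  W v = x v - lift x (back v)

  W-telescopes : ∀ v → W v +ℚ lift x (back v) ≡ x v
  W-telescopes v = minus-+ (x v) (lift x (back v))

  W-nonneg : ∀ v → 0ℚ ≤ℚ W v
  W-nonneg v = minus-nonneg (back-below v)
    where
    back-below : ∀ v → lift x (back v) ≤ℚ x v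
    back-below v with back v in bk
    ... | nothing = x-nonneg v
    ... | just w  = x-step (back-step bk)

  W≤x : ∀ v → W v ≤ℚ x v
  W≤x v = minus-≤ (lift-nonneg (back v))
    where
    lift-nonneg : ∀ m → 0ℚ ≤ℚ lift x m
    lift-nonneg nothing  = ℚ.≤-refl
    lift-nonneg (just w) = x-nonneg w

  path-positive : ∀ {u v} → 0ℚ <ℚ W u → v ∈ path u → 0ℚ <ℚ x v
  path-positive {u} pos v∈ = ℚ.<-≤-trans pos (ℚ.≤-trans (W≤x u) (All.lookup above-start v∈))
    where
    above-start : All (λ v → x u ≤ℚ x v) (path u)
    above-start = orbit-invariant (λ xu≤ st → ℚ.≤-trans xu≤ (x-step st)) (k + n) ℚ.≤-refl

  onPath : Node → Node → ℚ
  onPath u v = if does (v ∈? path u) then W u else 0ℚ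

  path-forward : ∀ {u v w} → back v ≡ just w → w ∈ path u → v ∈ path u
  path-forward {u} bk w∈ = orbit-closed (k + n) (enough-fuel u) w∈ (back-step bk)

  path-backward : ∀ {u v} → u ≢ v → v ∈ path u → ∃ λ w → back v ≡ just w × w ∈ path u
  path-backward u≢v v∈ with orbit-pred (k + n) v∈
  ... | inj₁ v≡u           = ⊥-elim (u≢v (sym v≡u))
  ... | inj₂ (w , w∈ , st) = w , step-back st , w∈

  onPath-back : ∀ u v → u ≢ v → onPath u v ≡ lift (onPath u) (back v)
  onPath-back u v u≢v with back v in bk
  ... | nothing = dec-off (v ∈? path u) (λ v∈ → nothing≢just (trans (sym bk) (proj₁ (proj₂ (path-backward u≢v v∈)))))
    where
    nothing≢just : ∀ {w : Node} → nothing ≢ just w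
    nothing≢just ()
  ... | just w  = dec-cong (v ∈? path u) (w ∈? path u) (mk⇔ backward (path-forward bk))
    where
    backward : v ∈ path u → w ∈ path u
    backward v∈ with w′ , bk′ , w′∈ ← path-backward u≢v v∈ with refl ← trans (sym bk) bk′ = w′∈

  onPath-start : ∀ u → onPath u u ≡ W u +ℚ lift (onPath u) (back u)
  onPath-start u = begin
    onPath u u                         ≡⟨ dec-on (u ∈? path u) (start∈orbit (k + n) u) ⟩
    W u                                ≡⟨ sym (ℚ.+-identityʳ (W u)) ⟩
    W u +ℚ 0ℚ                          ≡⟨ cong (W u +ℚ_) (sym (no-return (back u) refl)) ⟩
    W u +ℚ lift (onPath u) (back u)    ∎
    where
    open ≡-Reasoning
    no-return : ∀ m → back u ≡ m → lift (onPath u) m ≡ 0ℚ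
    no-return nothing  _  = refl
    no-return (just w) bk = dec-off (w ∈? path u) (λ w∈ → path-no-return w∈ (back-step bk))

  atStart : Node → Node → ℚ
  atStart u v = if does (u ≟ₙ v) then W u else 0ℚ

  onPath-split : ∀ u v → onPath u v ≡ atStart u v +ℚ lift (onPath u) (back v)
  onPath-split u v with u ≟ₙ v
  ... | yes refl = onPath-start u
  ... | no u≢v   = trans (onPath-back u v u≢v) (sym (ℚ.+-identityˡ _))

  Items Slots : List ℕ
  Items = interval 1 n
  Slots = interval (suc k) (k + n)

  Grid : List Node
  Grid = cartesianProduct Items Slots

  ∈Grid⁺ : ∀ {v} → InGrid v → v ∈ Grid
  ∈Grid⁺ ((1≤a , a≤n) , k<s , s≤) = ∈-cartesianProduct⁺ (∈-interval⁺ 1≤a a≤n) (∈-interval⁺ k<s s≤)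

  ∈Grid⁻ : ∀ {v} → v ∈ Grid → InGrid v
  ∈Grid⁻ {a , s} v∈ with ∈-cartesianProduct⁻ Items Slots v∈
  ... | a∈ , s∈ = ∈-interval⁻ a∈ , ∈-interval⁻ s∈

  Grid-unique : Unique Grid
  Grid-unique = Unique.cartesianProduct⁺ (interval-unique 1 n) (interval-unique (suc k) (k + n))

  cover : Node → ℚ
  cover v = sumℚ (λ u → onPath u v) Grid

  cover-step : ∀ {v} → InGrid v → cover v ≡ W v +ℚ lift cover (back v)
  cover-step {v} g = begin
    sumℚ (λ u → onPath u v) Grid                                 ≡⟨ sum-cong Grid (λ {u} _ → onPath-split u v) ⟩
    sumℚ (λ u → atStart u v +ℚ before u) Grid                    ≡⟨ sum-+ (λ u → atStart u v) before Grid ⟩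
    sumℚ (λ u → atStart u v) Grid +ℚ sumℚ before Grid            ≡⟨ cong₂ _+ℚ_ only-v (sum-lift (back v)) ⟩
    W v +ℚ lift cover (back v)                                   ∎
    where
    open ≡-Reasoning
    before : Node → ℚ
    before u = lift (onPath u) (back v)
    only-v : sumℚ (λ u → atStart u v) Grid ≡ W v
    only-v = trans (sum-single Grid Grid-unique (∈Grid⁺ g) (λ {u} _ u≢v → dec-off (u ≟ₙ v) u≢v)) (dec-on (v ≟ₙ v) refl)
    sum-lift : ∀ m → sumℚ (λ u → lift (onPath u) m) Grid ≡ lift cover m
    sum-lift nothing  = sum-zero Grid (λ _ → refl)
    sum-lift (just w) = refl

  -- paths started in the grid stay in it
  cover-outside : ∀ {v} → ¬ InGrid v → cover v ≡ 0ℚ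
  cover-outside {v} ¬g = sum-zero Grid (λ {u} u∈ →
    dec-off (v ∈? path u) (λ v∈ → ¬g (All.lookup (path-grid (∈Grid⁻ u∈)) v∈)))

  mutual
    cover≡x : ∀ t b → cover (b , t) ≡ x (b , t)
    cover≡x t b with inGrid? (b , t)
    ... | no ¬g = trans (cover-outside ¬g) (sym (x-nonvariable (¬g ∘ proj₁)))
    ... | yes g = begin
      cover (b , t)                               ≡⟨ cover-step g ⟩
      W (b , t) +ℚ lift cover (back (b , t))      ≡⟨ cong (W (b , t) +ℚ_) (cover≡x-back t b) ⟩
      W (b , t) +ℚ lift x (back (b , t))          ≡⟨ W-telescopes (b , t) ⟩
      x (b , t)                                   ∎
      where open ≡-Reasoning

    cover≡x-back : ∀ t b → lift cover (back (b , t)) ≡ lift x (back (b , t))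
    cover≡x-back zero    b = refl
    cover≡x-back (suc t) b with back (b , suc t) in bk
    ... | nothing      = refl
    ... | just (a , s) with step-sound {a} {s} {b} {suc t} (back-step bk)
    ...   | record { next-slot = refl } = cover≡x s a

module Decomposition (k n : ℕ) (c : ℕ → ℕ) (X : ℕ → ℕ → ℚ) (feasible : Instance.Feasible k n c X) where
  open Instance k n c
  open NextItem k n c
  open Staircase k n c
  open Increments k n c X feasible
  open import Data.List.Membership.DecPropositional _≟ₙ_ using (_∈?_)

  entry : Node → Entry
  entry u = map proj₁ (path u) , proj₂ u ∸ 1 , W u

  positive? : ∀ u → Dec (0ℚ <ℚ W u)
  positive? u = 0ℚ ℚ.<? W u

  starts : List Node
  starts = filter positive? Grid

  msms : List Entry
  msms = map entry starts

  ∈starts⁻ : ∀ {u} → u ∈ starts → u ∈ Grid × 0ℚ <ℚ W u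
  ∈starts⁻ = ∈-filter⁻ positive?

  end-gap : ∀ {a s} → InGrid (a , s) → 0ℚ <ℚ x (a , s) → step (a , s) ≡ nothing → suc (suc s) ≤ nxt a
  end-gap {a} {s} g pos end = by-cases (nxt a ℕ.≤? suc s) (suc s ℕ.≤? k + n)
    where
    by-cases : Dec (nxt a ≤ suc s) → Dec (suc s ≤ k + n) → suc (suc s) ≤ nxt a
    by-cases (no n≰)  _             = ℕ.≰⇒> n≰
    by-cases (yes n≤) (yes inside)  = ⊥-elim (step-end end (n≤ , inside))
    by-cases (yes n≤) (no beyond)   = ⊥-elim (ℚ.<-irrefl (sym (x-horizon g n≤ beyond)) pos)

  first-slot-bound : ∀ {i} → IsItem i → suc k ⊔ i ≤ suc (k + n)
  first-slot-bound (_ , i≤n) = ℕ.⊔-lub (s≤s (ℕ.m≤m+n k n)) (ℕ.≤-trans i≤n (ℕ.≤-trans (ℕ.m≤n+m n k) (ℕ.n≤1+n _)))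

  entry-MSM : ∀ {u} → u ∈ Grid → 0ℚ <ℚ W u → IsMSM (seqOf (entry u)) (startOf (entry u))
  entry-MSM {a , zero}   u∈ pos with () ← proj₁ (proj₂ (∈Grid⁻ u∈))
  entry-MSM {a , suc s₀} u∈ pos = nonempty , items , path-chain (k + n) (a , suc s₀) , fits , end-ok
    where
    u = a , suc s₀
    nonempty : map proj₁ (path u) ≢ []
    nonempty eq with orbit-head (k + n) u
    ... | l , eq′ rewrite eq′ with eq
    ...   | ()
    items : All IsItem (map proj₁ (path u))
    items = AllP.map⁺ (All.map proj₁ (path-grid (∈Grid⁻ u∈)))
    fits : Fits s₀ (map proj₁ (path u))
    fits = fits-nodes s₀ (path u) (path-slots (k + n) a (suc s₀))
             (All.tabulate (λ {v} v∈ → proj₂ (x-positive (path-positive pos v∈))))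
    end-ok : EndOK s₀ (map proj₁ (path u))
    end-ok i lst with path-end a (suc s₀)
    ... | (i′ , s′) , lst′ , end , slot with refl ← MaybeP.just-injective (trans (sym lst) (last-item (path u) lst′)) =
      subst (_< nxt i ∸ 1) (sym last-time) (ℕ.∸-monoˡ-≤ 1 (end-gap (grid v∈) (path-positive pos v∈) end))
      where
      v∈ = last-∈ (path u) lst′
      grid = All.lookup (path-grid (∈Grid⁻ u∈))
      last-time : s₀ + length (map proj₁ (path u)) ≡ s′
      last-time = ℕ.suc-injective (trans (cong (λ m → suc (s₀ + m)) (length-map proj₁ (path u))) slot)

  msms-MSM : All (λ e → IsMSM (seqOf e) (startOf e)) msms
  msms-MSM = AllP.map⁺ (All.tabulate (λ u∈ → let u∈G , pos = ∈starts⁻ u∈ in entry-MSM u∈G pos))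

  msms-nonneg : All (λ e → 0ℚ ≤ℚ weight e) msms
  msms-nonneg = AllP.map⁺ (All.tabulate (λ {u} _ → W-nonneg u))

  -- the key (I, j) of an entry determines its start: I begins with its item, j is its slot - 1
  key-entry-injective : ∀ {u v} → u ∈ Grid → v ∈ Grid → key (entry u) ≡ key (entry v) → u ≡ v
  key-entry-injective {a , zero}  u∈ _  _ with () ← proj₁ (proj₂ (∈Grid⁻ u∈))
  key-entry-injective {_ , suc _} {b , zero} _ v∈ _ with () ← proj₁ (proj₂ (∈Grid⁻ v∈))
  key-entry-injective {a , suc s} {b , suc t} _ _ eq
    with orbit-head (k + n) (a , suc s) | orbit-head (k + n) (b , suc t)
  ... | l , eqᵤ | m , eqᵥ rewrite eqᵤ | eqᵥ =
    cong₂ _,_ (∷-injectiveˡ (cong proj₁ eq)) (cong suc (cong proj₂ eq))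

  msms-keys-unique : Unique (map key msms)
  msms-keys-unique = subst Unique (map-∘ starts)
    (map-unique (key ∘ entry) (λ u∈ v∈ → key-entry-injective (proj₁ (∈starts⁻ u∈)) (proj₁ (∈starts⁻ v∈)))
                (Unique.filter⁺ positive? Grid-unique))

  sumWhere-msms : ∀ p → sumWhere p msms ≡ sumℚ (λ u → if p (entry u) then W u else 0ℚ) Grid
  sumWhere-msms p = trans (sum-map (λ e → if p e then weight e else 0ℚ) entry starts)
    (trans (sum-filter positive? _ Grid) (sum-cong Grid (λ {u} _ → dec-drop (positive? u) (λ ¬pos →
      indicator-zero (p (entry u)) (ℚ.≤-antisym (ℚ.≮⇒≥ ¬pos) (W-nonneg u))))))

  Meets : Node → List Node → Set
  Meets u S = ∃ λ v → v ∈ S × v ∈ path u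

  AtMostOnce : Node → List Node → Set
  AtMostOnce u S = ∀ {v v′} → v ∈ S → v′ ∈ S → v ∈ path u → v′ ∈ path u → v ≡ v′

  weight-meets : (b : Bool) (u : Node) (S : List Node) → Unique S → AtMostOnce u S → (T b ⇔ Meets u S) →
    (if b then W u else 0ℚ) ≡ sumℚ (onPath u) S
  weight-meets b u S uniq once meets = indicator b
    (λ tb → let v , v∈S , v∈P = Equivalence.to meets tb in sym
      (trans (sum-single S uniq v∈S (λ {w} w∈S w≢v → dec-off (w ∈? path u) (λ w∈P → w≢v (once w∈S v∈S w∈P v∈P))))
             (dec-on (v ∈? path u) v∈P)))
    (λ ¬tb → sym (sum-zero S (λ {w} w∈S → dec-off (w ∈? path u) (λ w∈P → ¬tb (Equivalence.from meets (w , w∈S , w∈P))))))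

  sum-selected : ∀ (p : Entry → Bool) (S : List Node) → Unique S →
    (∀ {u} → u ∈ Grid → AtMostOnce u S × (T (p (entry u)) ⇔ Meets u S)) →
    sumWhere p msms ≡ sumℚ x S
  sum-selected p S uniq selects = begin
    sumWhere p msms                                         ≡⟨ sumWhere-msms p ⟩
    sumℚ (λ u → if p (entry u) then W u else 0ℚ) Grid       ≡⟨ sum-cong Grid (λ {u} u∈ → let once , meets = selects u∈ in
                                                                 weight-meets (p (entry u)) u S uniq once meets) ⟩
    sumℚ (λ u → sumℚ (onPath u) S) Grid                     ≡⟨ sum-exchange onPath Grid S ⟩
    sumℚ cover S                                            ≡⟨ sum-cong S (λ {v} _ → cover≡x (proj₂ v) (proj₁ v)) ⟩
    sumℚ x S                                                ∎
    where open ≡-Reasoning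

  -- (a): the MSMs containing item i are those whose path meets row i.
  row : ℕ → List Node
  row i = map (i ,_) Slots

  contains-meets : ∀ {u} i → u ∈ Grid → T (contains i (entry u)) ⇔ Meets u (row i)
  contains-meets {u} i u∈ = mk⇔ to from
    where
    to : T (contains i (entry u)) → Meets u (row i)
    to has with find (any⁻ (_≡ᵇ i) (map proj₁ (path u)) has)
    ... | a , a∈ , a≡ᵇi with ∈-map⁻ proj₁ a∈ | ℕ.≡ᵇ⇒≡ a i a≡ᵇi
    ...   | (a , t) , v∈ , refl | refl =
      (a , t) , ∈-map⁺ (a ,_) (∈-interval⁺ (proj₁ (proj₂ g)) (proj₂ (proj₂ g))) , v∈
      where g = All.lookup (path-grid (∈Grid⁻ u∈)) v∈
    from : Meets u (row i) → T (contains i (entry u))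
    from (v , v∈row , v∈) with ∈-map⁻ (i ,_) v∈row
    ... | t , _ , refl = any⁺ (_≡ᵇ i) (lose (∈-map⁺ proj₁ v∈) (ℕ.≡⇒≡ᵇ i i refl))

  contains-once : ∀ i → IsItem i → sumWhere (contains i) msms ≡ 1ℚ
  contains-once i item = begin
    sumWhere (contains i) msms              ≡⟨ sum-selected (contains i) (row i) row-unique
                                                 (λ u∈ → (λ v∈ v′∈ → path-same-row v∈ v′∈) , contains-meets i u∈) ⟩
    sumℚ x (row i)                          ≡⟨ sum-map x (i ,_) Slots ⟩
    sumℚ (λ j → xv X i j) Slots             ≡⟨ sum-subinterval (xv X i) (xv X i) (ℕ.m≤m⊔n (suc k) i) ℕ.≤-refl
                                                 (first-slot-bound item) (λ _ _ → refl) outside ⟩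
    Σ[ suc k ⊔ i , k + n ] (λ j → xv X i j) ≡⟨ item-constraint i item ⟩
    1ℚ                                      ∎
    where
    open ≡-Reasoning
    row-unique : Unique (row i)
    row-unique = Unique.map⁺ (cong proj₂) (interval-unique (suc k) (k + n))
    path-same-row : ∀ {u v v′} → v ∈ row i → v′ ∈ row i → v ∈ path u → v′ ∈ path u → v ≡ v′
    path-same-row v∈row v′∈row v∈ v′∈ with ∈-map⁻ (i ,_) v∈row | ∈-map⁻ (i ,_) v′∈row
    ... | _ , _ , refl | _ , _ , refl = path-same v∈ v′∈ (inj₁ refl)
    outside : ∀ {j} → suc k ≤ j → j ≤ k + n → j < suc k ⊔ i ⊎ k + n < j → xv X i j ≡ 0ℚ
    outside k<j j≤ (inj₁ j<) = x-nonvariable (λ var → ℕ.<-irrefl refl (ℕ.<-≤-trans j< (ℕ.⊔-lub k<j (proj₂ var))))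
    outside k<j j≤ (inj₂ <j) = ⊥-elim (ℕ.<-irrefl refl (ℕ.<-≤-trans <j j≤))

  -- (b): the MSMs covering slot t are those whose path meets column t.
  column : ℕ → List Node
  column t = map (_, t) Items

  covers-meets : ∀ {u} t → u ∈ Grid → T (covers t (entry u)) ⇔ Meets u (column t)
  covers-meets {a , zero}   t u∈ with () ← proj₁ (proj₂ (∈Grid⁻ u∈))
  covers-meets {a , suc s₀} t u∈ = mk⇔ to from
    where
    u = a , suc s₀
    len = length (map proj₁ (path u))
    slots : map proj₂ (path u) ≡ range (suc s₀) len
    slots = trans (path-slots (k + n) a (suc s₀)) (cong (range (suc s₀)) (sym (length-map proj₁ (path u))))
    in-column : ∀ {v} → v ∈ path u → proj₂ v ≡ t → v ∈ column t
    in-column {b , _} v∈ refl = ∈-map⁺ (_, t) (∈-interval⁺ (proj₁ (proj₁ g)) (proj₂ (proj₁ g)))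
      where g = All.lookup (path-grid (∈Grid⁻ u∈)) v∈
    to : T (covers t (entry u)) → Meets u (column t)
    to cov with lo , hi ← Equivalence.to (T-∧ {suc s₀ ≤ᵇ t}) cov
      with t∈ ← ∈-range⁺ (ℕ.≤ᵇ⇒≤ (suc s₀) t lo) (s≤s (ℕ.≤ᵇ⇒≤ t (s₀ + len) hi))
      with v , v∈ , t≡ ← ∈-map⁻ proj₂ (subst (t ∈_) (sym slots) t∈) = v , in-column v∈ (sym t≡) , v∈
    from : Meets u (column t) → T (covers t (entry u))
    from (v , v∈col , v∈) with ∈-map⁻ (_, t) v∈col
    ... | b , _ , refl with ∈-range⁻ (subst (t ∈_) slots (∈-map⁺ proj₂ v∈))
    ...   | lo , hi = Equivalence.from T-∧ (ℕ.≤⇒≤ᵇ lo , ℕ.≤⇒≤ᵇ (ℕ.≤-pred hi))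

  covers-once : ∀ t → suc k ≤ t → t ≤ k + n → sumWhere (covers t) msms ≡ 1ℚ
  covers-once t k<t t≤ = begin
    sumWhere (covers t) msms                ≡⟨ sum-selected (covers t) (column t) column-unique
                                                 (λ u∈ → (λ v∈ v′∈ → path-same-column v∈ v′∈) , covers-meets t u∈) ⟩
    sumℚ x (column t)                       ≡⟨ sum-map x (_, t) Items ⟩
    sumℚ (λ i → xv X i t) Items             ≡⟨ sum-subinterval (λ i → xv X i t) (λ i → xv X i t)
                                                 ℕ.≤-refl (ℕ.m⊓n≤n t n) (s≤s z≤n) (λ _ _ → refl) outside ⟩
    Σ[ 1 , t ⊓ n ] (λ i → xv X i t)         ≡⟨ slot-constraint t k<t t≤ ⟩
    1ℚ                                      ∎
    where
    open ≡-Reasoning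
    column-unique : Unique (column t)
    column-unique = Unique.map⁺ (cong proj₁) (interval-unique 1 n)
    path-same-column : ∀ {u v v′} → v ∈ column t → v′ ∈ column t → v ∈ path u → v′ ∈ path u → v ≡ v′
    path-same-column v∈col v′∈col v∈ v′∈ with ∈-map⁻ (_, t) v∈col | ∈-map⁻ (_, t) v′∈col
    ... | _ , _ , refl | _ , _ , refl = path-same v∈ v′∈ (inj₂ refl)
    outside : ∀ {i} → 1 ≤ i → i ≤ n → i < 1 ⊎ t ⊓ n < i → xv X i t ≡ 0ℚ
    outside 1≤i i≤n (inj₁ i<1) = ⊥-elim (ℕ.<-irrefl refl (ℕ.<-≤-trans i<1 1≤i))
    outside 1≤i i≤n (inj₂ <i)  = x-nonvariable (λ var → ℕ.<-irrefl refl (ℕ.<-≤-trans <i (ℕ.⊓-glb (proj₂ var) i≤n)))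

  -- (c): every path has exactly one end, and in row i the ends carrying x
  -- are the slots up to n(i) - 2.
  IsEnd : Node → Set
  IsEnd v = step v ≡ nothing

  isEnd? : ∀ v → Dec (IsEnd v)
  isEnd? v = MaybeP.≡-dec _≟ₙ_ (step v) nothing

  ends : List Node
  ends = filter isEnd? Grid

  ends-unique : Unique ends
  ends-unique = Unique.filter⁺ isEnd? Grid-unique

  xEnd : Node → ℚ
  xEnd v = if does (isEnd? v) then x v else 0ℚ

  ends-selected : ∀ {u} → u ∈ Grid → AtMostOnce u ends × (T true ⇔ Meets u ends)
  ends-selected {a , s} u∈ = once , mk⇔ (λ _ → meets) (λ _ → tt)
    where
    end : ∀ {v} → v ∈ ends → IsEnd v
    end v∈ = proj₂ (∈-filter⁻ isEnd? {xs = Grid} v∈)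
    once : AtMostOnce (a , s) ends
    once v∈ v′∈ v∈P v′∈P = orbit-end-unique (k + n) v∈P v′∈P (end v∈) (end v′∈)
    meets : Meets (a , s) ends
    meets with v , lst , end , _ ← path-end a s =
      let v∈ = last-∈ (path (a , s)) lst in
      v , ∈-filter⁺ isEnd? (∈Grid⁺ (All.lookup (path-grid (∈Grid⁻ u∈)) v∈)) end , v∈

  ends-in-row : ∀ {i} → IsItem i → sumℚ (λ j → xEnd (i , j)) Slots ≡ Σ[ suc k ⊔ i , nxt i ∸ 2 ] (λ j → xv X i j)
  ends-in-row {i} item = sum-subinterval _ (xv X i) (ℕ.m≤m⊔n (suc k) i) b≤B (first-slot-bound item) inside outside
    where
    b≤B : nxt i ∸ 2 ≤ k + n
    b≤B = ℕ.≤-trans (ℕ.∸-monoˡ-≤ 2 (nxt-bound i)) (ℕ.≤-reflexive (ℕ.m+n∸n≡m (k + n) 2))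
    gap : ∀ {j m} → 1 ≤ j → j ≤ m ∸ 2 → suc (suc j) ≤ m
    gap {m = suc (suc m)} _   j≤ = s≤s (s≤s j≤)
    gap {m = zero}        1≤j j≤ = ⊥-elim (ℕ.<-irrefl refl (ℕ.<-≤-trans 1≤j j≤))
    gap {m = suc zero}    1≤j j≤ = ⊥-elim (ℕ.<-irrefl refl (ℕ.<-≤-trans 1≤j j≤))
    no-gap : ∀ {j m} → m ∸ 2 < j → m ≤ suc j
    no-gap {m = zero}        _  = z≤n
    no-gap {m = suc zero}    _  = s≤s z≤n
    no-gap {m = suc (suc m)} <j = s≤s <j
    -- before n(i) - 1 the node (i, j) is an end
    inside : ∀ {j} → suc k ⊔ i ≤ j → j ≤ nxt i ∸ 2 → xEnd (i , j) ≡ xv X i j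
    inside {j} a≤j j≤b = dec-on (isEnd? (i , j)) (step-unlinked λ (n≤ , _) →
      ℕ.<-irrefl refl (ℕ.<-≤-trans (gap (ℕ.≤-trans (s≤s z≤n) (ℕ.m⊔n≤o⇒m≤o (suc k) i a≤j)) j≤b) n≤))
    -- before the first slot of i there is no variable; from n(i) - 1 on, (i, j)
    -- is linked, except at the horizon where x vanishes
    outside : ∀ {j} → suc k ≤ j → j ≤ k + n → j < suc k ⊔ i ⊎ nxt i ∸ 2 < j → xEnd (i , j) ≡ 0ℚ
    outside k<j j≤ (inj₁ j<) = indicator-zero (does (isEnd? (i , _)))
      (x-nonvariable (λ var → ℕ.<-irrefl refl (ℕ.<-≤-trans j< (ℕ.⊔-lub k<j (proj₂ var)))))
    outside {j} k<j j≤ (inj₂ <j) = by-cases (suc j ℕ.≤? k + n)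
      where
      just≢nothing : ∀ {v : Node} → just v ≢ nothing
      just≢nothing ()
      by-cases : Dec (suc j ≤ k + n) → xEnd (i , j) ≡ 0ℚ
      by-cases (yes inside′) = dec-off (isEnd? (i , j)) (λ end → just≢nothing (trans (sym (step-linked (no-gap <j , inside′))) end))
      by-cases (no beyond)   = indicator-zero (does (isEnd? (i , j))) (x-horizon (item , k<j , j≤) (no-gap <j) beyond)

  total-weight : z X ≡ sumℚ weight msms
  total-weight = sym (begin
    sumℚ weight msms                                ≡⟨ sum-selected (λ _ → true) ends ends-unique ends-selected ⟩
    sumℚ x ends                                     ≡⟨ sum-filter isEnd? x Grid ⟩
    sumℚ xEnd Grid                                  ≡⟨ sum-cartesian xEnd Items Slots ⟩
    sumℚ (λ i → sumℚ (λ j → xEnd (i , j)) Slots) Items ≡⟨ sum-cong Items (λ i∈ → ends-in-row (∈-interval⁻ i∈)) ⟩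
    z X                                             ∎)
    where open ≡-Reasoning

proposition6 : (k n : ℕ) (c : ℕ → ℕ) (X : ℕ → ℕ → ℚ) →
    Instance.Feasible k n c X →
    Σ (List (Instance.Entry k n c)) λ L →
        All (λ e → Instance.IsMSM k n c (Instance.seqOf k n c e) (Instance.startOf k n c e)) L
      × All (λ e → 0ℚ ≤ℚ Instance.weight k n c e) L
      × Unique (map (Instance.key k n c) L)
      × (∀ i → Instance.IsItem k n c i → Instance.sumWhere k n c (Instance.contains k n c i) L ≡ 1ℚ)
      × (∀ t → suc k ≤ t → t ≤ k + n → Instance.sumWhere k n c (Instance.covers k n c t) L ≡ 1ℚ)
      × (Instance.z k n c X ≡ sumℚ (Instance.weight k n c) L)
proposition6 k n c X feasible =
  msms , msms-MSM , msms-nonneg , msms-keys-unique , contains-once , covers-once , total-weight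
  where open Decomposition k n c X feasible
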